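{- Let $F:\mathbb{N}^+\times\mathbb{N}^+\to\mathbb{N}^+$ be defined by $$F(m,n)=\frac{1}{4}\left[(m+n-1)^2-\big((m+n-1)\bmod 2\big)\right]+\min(m,n).$$ Let $S_O=\{(x,y)\in\mathbb{N}^+\times\mathbb{N}^+ : x\ge y\}$. Then the restriction of $F$ to $S_O$ is a surjection from $S_O$ onto $\mathbb{N}^+$.
   Context: $\mathbb{N}^+$ denotes the set of positive integers. For an integer $k$, $k\bmod 2$ denotes the least non-negative residue of $k$ modulo $2$. -}

module Defs where

open import Data.Nat using (ℕ; _+_; _*_; _∸_; _⊓_; _/_; _%_)

-- F(m,n) = ((m+n-1)^2 - ((m+n-1) mod 2)) / 4 + min(m,n), for m n ≥ 1.
-- The bracket is always divisible by 4, so ℕ floor division is exact.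
F : ℕ → ℕ → ℕ
F m n = (s * s ∸ s % 2) / 4 + (m ⊓ n)
  where
  s : ℕ
  s = m + n ∸ 1

module Submission where

-- On the antidiagonal x + y = s + 1 the cells with x ≥ y are y = 1, …, ⌈s/2⌉, where
-- F x y = ⌊s²/4⌋ + y. Moving one cell towards the main diagonal raises F by one, and
-- since ⌊(s+1)²/4⌋ = ⌊s²/4⌋ + ⌈s/2⌉, so does jumping from the last such cell to the
-- first cell (s + 1, 1) of the next antidiagonal. Starting from F 1 1 = 1, this walk
-- therefore attains every positive integer.

open import Defs
open import Data.List using ([]; _∷_)
open import Data.Nat using (ℕ; zero; suc; _+_; _*_; _∸_; _/_; _%_; _≤_; _<_; _≥_; s≤s; z≤n)
open import Data.Nat.DivMod using ([m+kn]%n≡m%n; m*n%n≡0; m*n/n≡m)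
open import Data.Nat.Properties using (+-comm; +-suc; m≥n⇒m⊓n≡n; m≤n⇒m<n∨m≡n; m≤n⇒m≤1+n; <⇒≤; ≤-refl; ≤-trans; n≤1+n)
open import Data.Nat.Tactic.RingSolver using (solve)
open import Data.Product using (∃₂; _×_; _,_)
open import Data.Sum using (inj₁; inj₂)
open import Relation.Binary.PropositionalEquality using (_≡_; refl; sym; trans; cong; module ≡-Reasoning)

open ≡-Reasoning

base : ℕ → ℕ
base s = (s * s ∸ s % 2) / 4

base-even : ∀ u → base (u * 2) ≡ u * u
base-even u = begin
  ((u * 2) * (u * 2) ∸ (u * 2) % 2) / 4 ≡⟨ cong (λ r → ((u * 2) * (u * 2) ∸ r) / 4) (m*n%n≡0 u 2) ⟩
  (u * 2) * (u * 2) / 4                 ≡⟨ cong (_/ 4) square ⟩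
  (u * u) * 4 / 4                       ≡⟨ m*n/n≡m (u * u) 4 ⟩
  u * u                                 ∎
  where
  square : (u * 2) * (u * 2) ≡ (u * u) * 4
  square = solve (u ∷ [])

base-odd : ∀ u → base (1 + u * 2) ≡ u * u + u
base-odd u = begin
  (s * s ∸ s % 2) / 4             ≡⟨ cong (λ r → (s * s ∸ r) / 4) ([m+kn]%n≡m%n 1 u 2) ⟩
  (s * s ∸ 1) / 4                 ≡⟨ cong (λ t → (t ∸ 1) / 4) square ⟩
  (1 + (u * u + u) * 4 ∸ 1) / 4   ≡⟨ m*n/n≡m (u * u + u) 4 ⟩
  u * u + u                       ∎
  where
  s : ℕ
  s = 1 + u * 2

  square : (1 + u * 2) * (1 + u * 2) ≡ 1 + (u * u + u) * 4
  square = solve (u ∷ [])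

F-antidiagonal : ∀ {m n} → n ≤ suc m → F (suc m) n ≡ base (m + n) + n
F-antidiagonal {m} {n} n≤1+m = cong (base (m + n) +_) (m≥n⇒m⊓n≡n n≤1+m)

F-towards-diagonal : ∀ {m n} → n < m → F m (suc n) ≡ suc (F (suc m) n)
F-towards-diagonal {suc m} {n} n<m = begin
  F (suc m) (suc n)          ≡⟨ F-antidiagonal n<m ⟩
  base (m + suc n) + suc n   ≡⟨ cong (λ s → base s + suc n) (+-suc m n) ⟩
  base (suc m + n) + suc n   ≡⟨ +-suc (base (suc m + n)) n ⟩
  suc (base (suc m + n) + n) ≡⟨ cong suc (sym (F-antidiagonal (m≤n⇒m≤1+n (<⇒≤ n<m)))) ⟩
  suc (F (suc (suc m)) n)    ∎

F-jump-from-diagonal : ∀ x → F (suc x + suc x) 1 ≡ suc (F (suc x) (suc x))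
F-jump-from-diagonal x = begin
  F (suc x + suc x) 1             ≡⟨ F-antidiagonal (s≤s z≤n) ⟩
  base (x + suc x + 1) + 1        ≡⟨ cong (λ s → base s + 1) next-sum ⟩
  base (suc x * 2) + 1            ≡⟨ cong (_+ 1) (base-even (suc x)) ⟩
  suc x * suc x + 1               ≡⟨ square ⟩
  suc (x * x + x + suc x)         ≡⟨ cong (λ b → suc (b + suc x)) (sym (base-odd x)) ⟩
  suc (base (1 + x * 2) + suc x)  ≡⟨ cong (λ s → suc (base s + suc x)) sum ⟩
  suc (base (x + suc x) + suc x)  ≡⟨ cong suc (sym (F-antidiagonal ≤-refl)) ⟩
  suc (F (suc x) (suc x))         ∎
  where
  next-sum : x + suc x + 1 ≡ suc x * 2
  next-sum = solve (x ∷ [])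
  square : suc x * suc x + 1 ≡ suc (x * x + x + suc x)
  square = solve (x ∷ [])
  sum : 1 + x * 2 ≡ x + suc x
  sum = solve (x ∷ [])

F-jump-from-superdiagonal : ∀ x → F (suc x + x) 1 ≡ suc (F (suc x) x)
F-jump-from-superdiagonal x = begin
  F (suc x + x) 1          ≡⟨ F-antidiagonal (s≤s z≤n) ⟩
  base (x + x + 1) + 1     ≡⟨ cong (λ s → base s + 1) next-sum ⟩
  base (1 + x * 2) + 1     ≡⟨ cong (_+ 1) (base-odd x) ⟩
  x * x + x + 1            ≡⟨ +-comm (x * x + x) 1 ⟩
  suc (x * x + x)          ≡⟨ cong (λ b → suc (b + x)) (sym (base-even x)) ⟩
  suc (base (x * 2) + x)   ≡⟨ cong (λ s → suc (base s + x)) sum ⟩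
  suc (base (x + x) + x)   ≡⟨ cong suc (sym (F-antidiagonal (n≤1+n x))) ⟩
  suc (F (suc x) x)        ∎
  where
  next-sum : x + x + 1 ≡ 1 + x * 2
  next-sum = solve (x ∷ [])
  sum : x * 2 ≡ x + x
  sum = solve (x ∷ [])

Attained : ℕ → Set
Attained k = ∃₂ λ (x y : ℕ) → 1 ≤ x × 1 ≤ y × x ≥ y × F x y ≡ k

attained-suc : ∀ {k} → Attained k → Attained (suc k)
attained-suc (x , suc y , _ , _ , y<x , Fxy≡k) with m≤n⇒m<n∨m≡n y<x
... | inj₂ refl =
  suc y + suc y , 1 , s≤s z≤n , s≤s z≤n , s≤s z≤n , trans (F-jump-from-diagonal y) (cong suc Fxy≡k)
... | inj₁ y+1<x with m≤n⇒m<n∨m≡n y+1<x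
...   | inj₂ refl =
  suc (suc y) + suc y , 1 , s≤s z≤n , s≤s z≤n , s≤s z≤n , trans (F-jump-from-superdiagonal (suc y)) (cong suc Fxy≡k)
...   | inj₁ (s≤s {n = m} y+2≤m) =
  m , suc (suc y) , ≤-trans (s≤s z≤n) y+2≤m , s≤s z≤n , y+2≤m , trans (F-towards-diagonal y+2≤m) (cong suc Fxy≡k)

attained : ∀ n → Attained (suc n)
attained zero    = 1 , 1 , s≤s z≤n , s≤s z≤n , s≤s z≤n , refl
attained (suc n) = attained-suc (attained n)

theorem2 : ∀ (k : ℕ) → 1 ≤ k →
    ∃₂ λ (x y : ℕ) → 1 ≤ x × 1 ≤ y × x ≥ y × F x y ≡ k
theorem2 (suc n) _ = attained n
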